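{- Let $G$ be a finite connected undirected graph. In any candy-passing game on $G$ with $c$ candies, where $c\geq 4|E(G)|-|V(G)|$, every vertex $v\in V(G)$ eventually stabilizes; that is, there is a finite number of rounds after which the number of candies held by each vertex remains constant in all subsequent rounds.
   Context: The candy-passing game on a finite undirected graph $G$ (with vertex set $V(G)$ and edge set $E(G)$): initially a total of $c>0$ candies is distributed among the vertices of $G$ (each vertex holding a nonnegative integer number of candies). The game proceeds in rounds. In each round, simultaneously, every vertex $v$ that at the start of the round holds at least $\deg(v)$ candies passes one candy to each of its neighbors; a vertex holding fewer than $\deg(v)$ candies at the start of the round passes nothing. Here $\deg(v)$ is the number of neighbors of $v$. A vertex is said to have stabilized after some round if the number of candies it holds remains constant throughout all subsequent rounds. -}

module Defs where

open import Data.Nat using (ℕ; zero; suc; _+_; _*_; _∸_; _≤_; _<_; _≤?_; _<?_)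
open import Data.Fin using (Fin; zero; suc; toℕ)
open import Data.Bool using (Bool; true; false; if_then_else_; _∧_)
open import Relation.Nullary.Decidable using (⌊_⌋)
open import Relation.Binary.PropositionalEquality using (_≡_)
open import Function using (_∘_)

sumFin : (n : ℕ) → (Fin n → ℕ) → ℕ
sumFin zero    f = 0
sumFin (suc n) f = f zero + sumFin n (f ∘ suc)

countFin : (n : ℕ) → (Fin n → Bool) → ℕ
countFin n p = sumFin n (λ i → if p i then 1 else 0)

record Graph (n : ℕ) : Set where
  field
    adj   : Fin n → Fin n → Bool
    sym   : ∀ u v → adj u v ≡ adj v u
    loopless : ∀ v → adj v v ≡ false
open Graph public

data Walk {n : ℕ} (G : Graph n) : Fin n → Fin n → Set where
  here : ∀ {v} → Walk G v v
  step : ∀ {u w v} → adj G u w ≡ true → Walk G w v → Walk G u v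

Connected : ∀ {n} → Graph n → Set
Connected {n} G = ∀ (u v : Fin n) → Walk G u v

deg : ∀ {n} → Graph n → Fin n → ℕ
deg {n} G v = countFin n (adj G v)

edgeCount : ∀ {n} → Graph n → ℕ
edgeCount {n} G = sumFin n (λ i → countFin n (λ j → ⌊ toℕ i <? toℕ j ⌋ ∧ adj G i j))

Config : ℕ → Set
Config n = Fin n → ℕ

total : ∀ {n} → Config n → ℕ
total {n} σ = sumFin n σ

fires : ∀ {n} → Graph n → Config n → Fin n → Bool
fires G σ v = ⌊ deg G v ≤? σ v ⌋

round : ∀ {n} → Graph n → Config n → Config n
round {n} G σ v =
  (σ v ∸ (if fires G σ v then deg G v else 0))
  + countFin n (λ u → adj G v u ∧ fires G σ u)

play : ∀ {n} → Graph n → Config n → ℕ → Config n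
play G σ zero    = σ
play G σ (suc t) = round G (play G σ t)

-- We prove more than stabilization: eventually every vertex fires in every
-- round, and a configuration in which all vertices fire is a fixed point.
--
-- The key quantity is the potential  Φ(τ) = Σ_v min (τ v , 2 deg v − 1).
-- Candies move net only along edges joining a firing and an idle vertex, so a
-- flow-balance argument shows that Φ never decreases, and that it increases
-- strictly when a vertex holding at least 2 deg v candies ("rich") has an idle
-- neighbour.  Since Σ_v (2 deg v − 1) = 4|E| − |V| (handshake lemma), every
-- configuration either has a rich vertex or has all vertices firing.
-- Over a window of L rounds in which Φ stays constant, a rich vertex x stays
-- rich and never idles.  An edge inequality on idle counts (each idle round of
-- a neighbour costs a firing vertex one candy) bounds, along a walk to x, the
-- number of idle rounds of every vertex by a constant H; taking L = H + 1, some
-- round of the window has all vertices firing.  As Φ is bounded by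
-- Σ_v (2 deg v − 1), all vertices fire after at most that many windows.

module Submission where

open import Defs hiding (sym)
open import Data.Nat using (ℕ; zero; suc; pred; _+_; _*_; _∸_; _⊓_; _≤_; _<_; z≤n; s≤s; z<s; _≤?_; _<?_)
open import Data.Nat.Properties
open import Data.Nat.Tactic.RingSolver using (solve-∀)
open import Algebra.Properties.CommutativeSemigroup +-commutativeSemigroup using (interchange)
open import Data.Fin using (Fin; zero; suc; toℕ)
open import Data.Fin.Properties using (toℕ-injective; any?)
open import Data.Bool using (Bool; true; false; if_then_else_; _∧_; not)
open import Data.Bool.Properties using (∧-zeroʳ; ∧-identityʳ; ¬-not) renaming (_≟_ to _≟ᵇ_)
open import Data.Product using (∃; _,_; _×_)
open import Data.Sum using (_⊎_; inj₁; inj₂)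
open import Data.Empty using (⊥-elim)
open import Relation.Nullary using (yes; no)
open import Relation.Nullary.Decidable using (⌊_⌋)
open import Relation.Binary.PropositionalEquality
open import Function using (_∘_)

ind : Bool → ℕ
ind b = if b then 1 else 0

sumFin-cong : ∀ n {f g : Fin n → ℕ} → (∀ i → f i ≡ g i) → sumFin n f ≡ sumFin n g
sumFin-cong zero    _  = refl
sumFin-cong (suc n) eq = cong₂ _+_ (eq zero) (sumFin-cong n (eq ∘ suc))

sumFin-mono : ∀ n {f g : Fin n → ℕ} → (∀ i → f i ≤ g i) → sumFin n f ≤ sumFin n g
sumFin-mono zero    _  = z≤n
sumFin-mono (suc n) le = +-mono-≤ (le zero) (sumFin-mono n (le ∘ suc))

sumFin-mono-< : ∀ n {f g : Fin n → ℕ} → (∀ i → f i ≤ g i) → ∀ j → f j < g j →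
  sumFin n f < sumFin n g
sumFin-mono-< (suc n) le zero    lt = +-mono-<-≤ lt (sumFin-mono n (le ∘ suc))
sumFin-mono-< (suc n) le (suc j) lt = +-mono-≤-< (le zero) (sumFin-mono-< n (le ∘ suc) j lt)

term≤sumFin : ∀ n (f : Fin n → ℕ) j → f j ≤ sumFin n f
term≤sumFin (suc n) f zero    = m≤m+n _ _
term≤sumFin (suc n) f (suc j) = ≤-trans (term≤sumFin n (f ∘ suc) j) (m≤n+m _ _)

sumFin-+ : ∀ n (f g : Fin n → ℕ) → sumFin n (λ i → f i + g i) ≡ sumFin n f + sumFin n g
sumFin-+ zero    f g = refl
sumFin-+ (suc n) f g =
  trans (cong (f zero + g zero +_) (sumFin-+ n (f ∘ suc) (g ∘ suc)))
        (interchange (f zero) (g zero) (sumFin n (f ∘ suc)) (sumFin n (g ∘ suc)))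

sumFin-const : ∀ n k → sumFin n (λ _ → k) ≡ n * k
sumFin-const zero    k = refl
sumFin-const (suc n) k = cong (k +_) (sumFin-const n k)

sumFin-scale : ∀ n k (f : Fin n → ℕ) → sumFin n (λ i → k * f i) ≡ k * sumFin n f
sumFin-scale zero    k f = sym (*-zeroʳ k)
sumFin-scale (suc n) k f =
  trans (cong (k * f zero +_) (sumFin-scale n k (f ∘ suc))) (sym (*-distribˡ-+ k (f zero) _))

sumFin-swap : ∀ n m (f : Fin n → Fin m → ℕ) →
  sumFin n (λ i → sumFin m (f i)) ≡ sumFin m (λ j → sumFin n (λ i → f i j))
sumFin-swap zero    m f = sym (trans (sumFin-const m 0) (*-zeroʳ m))
sumFin-swap (suc n) m f =
  trans (cong (sumFin m (f zero) +_) (sumFin-swap n m (f ∘ suc)))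
        (sym (sumFin-+ m (f zero) (λ j → sumFin n (λ i → f (suc i) j))))

sumFin-balance : ∀ n {f g x y : Fin n → ℕ} → (∀ i → f i + x i ≤ g i + y i) →
  sumFin n x ≡ sumFin n y → sumFin n f ≤ sumFin n g
sumFin-balance n {f} {g} {x} {y} le flow = +-cancelʳ-≤ (sumFin n x) _ _ (begin
  sumFin n f + sumFin n x     ≡⟨ sym (sumFin-+ n f x) ⟩
  sumFin n (λ i → f i + x i)  ≤⟨ sumFin-mono n le ⟩
  sumFin n (λ i → g i + y i)  ≡⟨ sumFin-+ n g y ⟩
  sumFin n g + sumFin n y     ≡⟨ cong (sumFin n g +_) (sym flow) ⟩
  sumFin n g + sumFin n x     ∎)
  where open ≤-Reasoning

sumFin-balance-< : ∀ n {f g x y : Fin n → ℕ} → (∀ i → f i + x i ≤ g i + y i) →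
  ∀ j → f j + x j < g j + y j → sumFin n x ≡ sumFin n y → sumFin n f < sumFin n g
sumFin-balance-< n {f} {g} {x} {y} le j lt flow = +-cancelʳ-≤ (sumFin n x) _ _ (begin-strict
  sumFin n f + sumFin n x     ≡⟨ sym (sumFin-+ n f x) ⟩
  sumFin n (λ i → f i + x i)  <⟨ sumFin-mono-< n le j lt ⟩
  sumFin n (λ i → g i + y i)  ≡⟨ sumFin-+ n g y ⟩
  sumFin n g + sumFin n y     ≡⟨ cong (sumFin n g +_) (sym flow) ⟩
  sumFin n g + sumFin n x     ∎)
  where open ≤-Reasoning

count-split : ∀ n (a b : Fin n → Bool) →
  countFin n a ≡ countFin n (λ i → a i ∧ b i) + countFin n (λ i → a i ∧ not (b i))
count-split n a b = trans (sumFin-cong n split) (sumFin-+ n _ _)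
  where
  split : ∀ i → ind (a i) ≡ ind (a i ∧ b i) + ind (a i ∧ not (b i))
  split i with a i | b i
  ... | true  | true  = refl
  ... | true  | false = refl
  ... | false | _     = refl

count-false : ∀ n (a : Fin n → Bool) → countFin n (λ i → a i ∧ false) ≡ 0
count-false n a =
  trans (sumFin-cong n (λ i → cong ind (∧-zeroʳ (a i)))) (trans (sumFin-const n 0) (*-zeroʳ n))

count≤n : ∀ n (a : Fin n → Bool) → countFin n a ≤ n
count≤n n a = subst (countFin n a ≤_) (trans (sumFin-const n 1) (*-identityʳ n)) (sumFin-mono n ind≤1)
  where
  ind≤1 : ∀ i → ind (a i) ≤ 1
  ind≤1 i with a i
  ... | true  = s≤s z≤n
  ... | false = z≤n

⊓-+-≤ : ∀ a b M → (a + b) ⊓ M ≤ a ⊓ M + b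
⊓-+-≤ a b M = ≤-trans (⊓-monoʳ-≤ (a + b) (m≤m+n M b)) (≤-reflexive (sym (+-distribʳ-⊓ b a M)))

⊓-+-> : ∀ a b M → M < a + b → 0 < b → M < a ⊓ M + b
⊓-+-> a b M M<a+b 0<b = subst (M <_) (sym (+-distribʳ-⊓ b a M)) (⊓-pres-m< M<a+b (m<m+n M 0<b))

pred-< : ∀ {m} → 0 < m → pred m < m
pred-< {suc m} _ = n<1+n m

pred+1 : ∀ {m} → 0 < m → pred m + 1 ≡ m
pred+1 {suc m} _ = +-comm m 1

double : ∀ d → d + d ≡ 2 * d
double d = cong (d +_) (sym (+-identityʳ d))

positive-of-double : ∀ d → 0 < 2 * d → 0 < d
positive-of-double (suc d) _ = z<s

budget-chain : ∀ a b e s₀ s₁ d p q → a + s₁ ≤ s₀ + d * p → b + e ≤ s₁ + d * q →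
  (a + b) + e ≤ s₀ + d * (p + q)
budget-chain a b e s₀ s₁ d p q first rest = begin
  (a + b) + e          ≡⟨ +-assoc a b e ⟩
  a + (b + e)          ≤⟨ +-monoʳ-≤ a rest ⟩
  a + (s₁ + d * q)     ≡⟨ sym (+-assoc a s₁ _) ⟩
  (a + s₁) + d * q     ≤⟨ +-monoˡ-≤ (d * q) first ⟩
  (s₀ + d * p) + d * q ≡⟨ +-assoc s₀ _ _ ⟩
  s₀ + (d * p + d * q) ≡⟨ cong (s₀ +_) (sym (*-distribˡ-+ d p q)) ⟩
  s₀ + d * (p + q)     ∎
  where open ≤-Reasoning

module _ {n : ℕ} (G : Graph n) where

  edge-swap : (p : Fin n → Fin n → Bool) →
    sumFin n (λ v → countFin n (λ u → adj G v u ∧ p v u)) ≡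
    sumFin n (λ v → countFin n (λ u → adj G v u ∧ p u v))
  edge-swap p = trans (sumFin-swap n n (λ v u → ind (adj G v u ∧ p v u)))
    (sumFin-cong n (λ u → sumFin-cong n (λ v → cong (λ b → ind (b ∧ p v u)) (Graph.sym G v u))))

  ordered-split : ∀ i j → ind (adj G i j) ≡
    ind (⌊ toℕ i <? toℕ j ⌋ ∧ adj G i j) + ind (⌊ toℕ j <? toℕ i ⌋ ∧ adj G j i)
  ordered-split i j with toℕ i <? toℕ j | toℕ j <? toℕ i
  ... | yes i<j | yes j<i = ⊥-elim (<-asym i<j j<i)
  ... | yes _   | no _    = sym (+-identityʳ _)
  ... | no _    | yes _   = cong ind (Graph.sym G i j)
  ... | no i≮j  | no j≮i  =
    cong ind (subst (λ k → adj G i k ≡ false) (toℕ-injective (≤-antisym (≮⇒≥ j≮i) (≮⇒≥ i≮j)))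
                    (Graph.loopless G i))

  degree-sum : sumFin n (deg G) ≡ edgeCount G + edgeCount G
  degree-sum = begin
    sumFin n (deg G)
      ≡⟨ sumFin-cong n (λ i → trans (sumFin-cong n (ordered-split i)) (sumFin-+ n _ _)) ⟩
    sumFin n (λ i → countFin n (λ j → ⌊ toℕ i <? toℕ j ⌋ ∧ adj G i j)
                  + countFin n (λ j → ⌊ toℕ j <? toℕ i ⌋ ∧ adj G j i))
      ≡⟨ sumFin-+ n _ _ ⟩
    edgeCount G + sumFin n (λ i → countFin n (λ j → ⌊ toℕ j <? toℕ i ⌋ ∧ adj G j i))
      ≡⟨ cong (edgeCount G +_) (sumFin-swap n n (λ i j → ind (⌊ toℕ j <? toℕ i ⌋ ∧ adj G j i))) ⟩
    edgeCount G + edgeCount G ∎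
    where open ≡-Reasoning

  -- The capacity 2 deg v − 1 of a vertex; an idle vertex never exceeds it after a
  -- round (idle-within-cap), while a rich vertex exceeds it.
  cap : Fin n → ℕ
  cap v = pred (2 * deg G v)

  cap-sum : (∀ v → 0 < deg G v) → sumFin n cap ≡ 4 * edgeCount G ∸ n
  cap-sum nonisolated = sym (trans (cong (_∸ n) four-E) (m+n∸n≡m _ n))
    where
    open ≡-Reasoning
    E = edgeCount G
    four : ∀ e → 4 * e ≡ 2 * (e + e)
    four = solve-∀
    four-E : 4 * E ≡ sumFin n cap + n
    four-E = begin
      4 * E                             ≡⟨ four E ⟩
      2 * (E + E)                       ≡⟨ cong (2 *_) (sym degree-sum) ⟩
      2 * sumFin n (deg G)              ≡⟨ sym (sumFin-scale n 2 (deg G)) ⟩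
      sumFin n (λ v → 2 * deg G v)      ≡⟨ sumFin-cong n (λ v →
                                             sym (pred+1 (≤-trans (nonisolated v) (m≤m+n _ _)))) ⟩
      sumFin n (λ v → cap v + 1)        ≡⟨ sumFin-+ n cap (λ _ → 1) ⟩
      sumFin n cap + sumFin n (λ _ → 1) ≡⟨ cong (sumFin n cap +_) (trans (sumFin-const n 1) (*-identityʳ n)) ⟩
      sumFin n cap + n                  ∎

  capped : Config n → Fin n → ℕ
  capped τ v = τ v ⊓ cap v

  potential : Config n → ℕ
  potential τ = sumFin n (capped τ)

  potential≤cap-sum : ∀ τ → potential τ ≤ sumFin n cap
  potential≤cap-sum τ = sumFin-mono n (λ v → m⊓n≤n _ _)

module OneRound {n : ℕ} (G : Graph n) (σ : Config n) where

  fire : Fin n → Bool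
  fire = fires G σ

  idle : Fin n → ℕ
  idle v = ind (not (fire v))

  firingNbrs : Fin n → ℕ
  firingNbrs v = countFin n (λ u → adj G v u ∧ fire u)

  idleNbrs : Fin n → ℕ
  idleNbrs v = countFin n (λ u → adj G v u ∧ not (fire u))

  deg-split : ∀ v → deg G v ≡ firingNbrs v + idleNbrs v
  deg-split v = count-split n (adj G v) fire

  firing-view : ∀ v → (fire v ≡ true × deg G v ≤ σ v) ⊎ (fire v ≡ false × σ v < deg G v)
  firing-view v with deg G v ≤? σ v
  ... | yes d≤σ = inj₁ (refl , d≤σ)
  ... | no  d≰σ = inj₂ (refl , ≰⇒> d≰σ)

  firing⇒enough : ∀ v → fire v ≡ true → deg G v ≤ σ v
  firing⇒enough v e with firing-view v
  ... | inj₁ (_ , d≤σ) = d≤σ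
  ... | inj₂ (e′ , _) with trans (sym e) e′
  ...   | ()

  rich-fires : ∀ v → 2 * deg G v ≤ σ v → fire v ≡ true
  rich-fires v rich with firing-view v
  ... | inj₁ (e , _)   = e
  ... | inj₂ (_ , σ<d) = ⊥-elim (<⇒≱ σ<d (≤-trans (m≤m+n _ _) rich))

  round-firing : ∀ v → fire v ≡ true → round G σ v + idleNbrs v ≡ σ v
  round-firing v e = begin
    round G σ v + idleNbrs v                          ≡⟨ cong (λ b → (σ v ∸ (if b then deg G v else 0)) + firingNbrs v + idleNbrs v) e ⟩
    (σ v ∸ deg G v) + firingNbrs v + idleNbrs v       ≡⟨ +-assoc (σ v ∸ deg G v) _ _ ⟩
    (σ v ∸ deg G v) + (firingNbrs v + idleNbrs v)     ≡⟨ cong ((σ v ∸ deg G v) +_) (sym (deg-split v)) ⟩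
    (σ v ∸ deg G v) + deg G v                         ≡⟨ m∸n+n≡m (firing⇒enough v e) ⟩
    σ v                                               ∎
    where open ≡-Reasoning

  round-idle : ∀ v → fire v ≡ false → round G σ v ≡ σ v + firingNbrs v
  round-idle v e = cong (λ b → (σ v ∸ (if b then deg G v else 0)) + firingNbrs v) e

  idle-within-cap : ∀ v → fire v ≡ false → round G σ v ≤ cap G v
  idle-within-cap v e with firing-view v
  ... | inj₁ (e′ , _) with trans (sym e) e′
  ...   | ()
  idle-within-cap v e | inj₂ (_ , σ<d) = <⇒≤pred (begin-strict
    round G σ v            ≡⟨ round-idle v e ⟩
    σ v + firingNbrs v     <⟨ +-mono-<-≤ σ<d (subst (firingNbrs v ≤_) (sym (deg-split v)) (m≤m+n _ _)) ⟩
    deg G v + deg G v      ≡⟨ double (deg G v) ⟩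
    2 * deg G v            ∎)
    where open ≤-Reasoning

  sent : Fin n → ℕ
  sent v = if fire v then deg G v else 0

  received≡sent : sumFin n firingNbrs ≡ sumFin n sent
  received≡sent = trans (edge-swap G (λ v u → fire u)) (sumFin-cong n sends)
    where
    sends : ∀ v → countFin n (λ u → adj G v u ∧ fire v) ≡ sent v
    sends v with fire v
    ... | true  = sumFin-cong n (λ u → cong ind (∧-identityʳ (adj G v u)))
    ... | false = count-false n (adj G v)

  sent≤ : ∀ v → sent v ≤ σ v
  sent≤ v with firing-view v
  ... | inj₁ (e , d≤σ) rewrite e = d≤σ
  ... | inj₂ (e , _)   rewrite e = z≤n

  conservation : total (round G σ) ≡ total σ
  conservation = begin
    sumFin n (λ v → (σ v ∸ sent v) + firingNbrs v)    ≡⟨ sumFin-+ n _ _ ⟩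
    sumFin n (λ v → σ v ∸ sent v) + sumFin n firingNbrs ≡⟨ cong (sumFin n (λ v → σ v ∸ sent v) +_) received≡sent ⟩
    sumFin n (λ v → σ v ∸ sent v) + sumFin n sent     ≡⟨ sym (sumFin-+ n _ _) ⟩
    sumFin n (λ v → σ v ∸ sent v + sent v)            ≡⟨ sumFin-cong n (λ v → m∸n+n≡m (sent≤ v)) ⟩
    sumFin n σ                                        ∎
    where open ≡-Reasoning

  idle≤idleNbrs : ∀ w v → adj G w v ≡ true → idle v ≤ idleNbrs w
  idle≤idleNbrs w v a = subst (_≤ idleNbrs w) (cong (λ b → ind (b ∧ not (fire v))) a)
                              (term≤sumFin n (λ u → ind (adj G w u ∧ not (fire u))) v)

  -- If a neighbour v of w is idle, then w either fires and loses the candy it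
  -- passes to v, or is idle itself and gains at most deg w candies.
  idle-transfer : ∀ w v → adj G w v ≡ true → idle v + round G σ w ≤ σ w + deg G w * idle w
  idle-transfer w v a with firing-view w
  ... | inj₁ (e , _) = begin
    idle v + round G σ w         ≤⟨ +-monoˡ-≤ (round G σ w) (idle≤idleNbrs w v a) ⟩
    idleNbrs w + round G σ w     ≡⟨ +-comm (idleNbrs w) _ ⟩
    round G σ w + idleNbrs w     ≡⟨ round-firing w e ⟩
    σ w                          ≤⟨ m≤m+n (σ w) _ ⟩
    σ w + deg G w * idle w       ∎
    where open ≤-Reasoning
  ... | inj₂ (e , _) = begin
    idle v + round G σ w               ≡⟨ cong (idle v +_) (round-idle w e) ⟩
    idle v + (σ w + firingNbrs w)      ≡⟨ rearrange (idle v) (σ w) (firingNbrs w) ⟩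
    σ w + (firingNbrs w + idle v)      ≤⟨ +-monoʳ-≤ (σ w) (+-monoʳ-≤ (firingNbrs w) (idle≤idleNbrs w v a)) ⟩
    σ w + (firingNbrs w + idleNbrs w)  ≡⟨ cong (σ w +_) (sym (deg-split w)) ⟩
    σ w + deg G w                      ≡⟨ cong (σ w +_) (sym (*-identityʳ (deg G w))) ⟩
    σ w + deg G w * 1                  ≡⟨ cong (λ b → σ w + deg G w * ind (not b)) (sym e) ⟩
    σ w + deg G w * idle w             ∎
    where
    open ≤-Reasoning
    rearrange : ∀ x s k → x + (s + k) ≡ s + (k + x)
    rearrange = solve-∀

  -- Net flow of candies happens only along boundary edges: from a firing
  -- vertex u to an idle neighbour v.  inflow counts these edges at the idle
  -- end, outflow at the firing end.
  boundary : Fin n → Fin n → Bool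
  boundary v u = not (fire v) ∧ fire u

  inflow : Fin n → ℕ
  inflow v = countFin n (λ u → adj G v u ∧ boundary v u)

  outflow : Fin n → ℕ
  outflow v = countFin n (λ u → adj G v u ∧ boundary u v)

  flow-balance : sumFin n inflow ≡ sumFin n outflow
  flow-balance = edge-swap G boundary

  inflow-firing : ∀ v → fire v ≡ true → inflow v ≡ 0
  inflow-firing v e = trans (cong (λ b → countFin n (λ u → adj G v u ∧ (not b ∧ fire u))) e)
                            (count-false n (adj G v))

  outflow-firing : ∀ v → fire v ≡ true → outflow v ≡ idleNbrs v
  outflow-firing v e = trans (cong (λ b → countFin n (λ u → adj G v u ∧ (not (fire u) ∧ b))) e)
    (sumFin-cong n (λ u → cong (λ b → ind (adj G v u ∧ b)) (∧-identityʳ (not (fire u)))))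

  inflow-idle : ∀ v → fire v ≡ false → inflow v ≡ firingNbrs v
  inflow-idle v e = cong (λ b → countFin n (λ u → adj G v u ∧ (not b ∧ fire u))) e

  outflow-idle : ∀ v → fire v ≡ false → outflow v ≡ 0
  outflow-idle v e = trans (cong (λ b → countFin n (λ u → adj G v u ∧ (not (fire u) ∧ b))) e)
    (trans (sumFin-cong n (λ u → cong (λ b → ind (adj G v u ∧ b)) (∧-zeroʳ (not (fire u)))))
           (count-false n (adj G v)))

  local-balance : ∀ v → capped G σ v + inflow v ≤ capped G (round G σ) v + outflow v
  local-balance v with firing-view v
  ... | inj₁ (e , _) = begin
    σ v ⊓ cap G v + inflow v                      ≡⟨ cong (σ v ⊓ cap G v +_) (inflow-firing v e) ⟩
    σ v ⊓ cap G v + 0                             ≡⟨ +-identityʳ _ ⟩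
    σ v ⊓ cap G v                                 ≡⟨ cong (_⊓ cap G v) (sym (round-firing v e)) ⟩
    (round G σ v + idleNbrs v) ⊓ cap G v          ≤⟨ ⊓-+-≤ (round G σ v) (idleNbrs v) (cap G v) ⟩
    round G σ v ⊓ cap G v + idleNbrs v            ≡⟨ cong (round G σ v ⊓ cap G v +_) (sym (outflow-firing v e)) ⟩
    round G σ v ⊓ cap G v + outflow v             ∎
    where open ≤-Reasoning
  ... | inj₂ (e , _) = begin
    σ v ⊓ cap G v + inflow v                      ≡⟨ cong (σ v ⊓ cap G v +_) (inflow-idle v e) ⟩
    σ v ⊓ cap G v + firingNbrs v                  ≤⟨ +-monoˡ-≤ (firingNbrs v) (m⊓n≤m (σ v) (cap G v)) ⟩
    σ v + firingNbrs v                            ≡⟨ sym (round-idle v e) ⟩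
    round G σ v                                   ≡⟨ sym (m≤n⇒m⊓n≡m (idle-within-cap v e)) ⟩
    round G σ v ⊓ cap G v                         ≡⟨ sym (+-identityʳ _) ⟩
    round G σ v ⊓ cap G v + 0                     ≡⟨ cong (round G σ v ⊓ cap G v +_) (sym (outflow-idle v e)) ⟩
    round G σ v ⊓ cap G v + outflow v             ∎
    where open ≤-Reasoning

  local-balance-strict : ∀ x → 2 * deg G x ≤ σ x → 0 < idleNbrs x →
    capped G σ x + inflow x < capped G (round G σ) x + outflow x
  local-balance-strict x rich busy = begin-strict
    σ x ⊓ cap G x + inflow x              ≡⟨ cong (σ x ⊓ cap G x +_) (inflow-firing x e) ⟩
    σ x ⊓ cap G x + 0                     ≡⟨ +-identityʳ _ ⟩
    σ x ⊓ cap G x                         ≤⟨ m⊓n≤n (σ x) (cap G x) ⟩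
    cap G x                               <⟨ ⊓-+-> (round G σ x) (idleNbrs x) (cap G x) cap<σ busy ⟩
    round G σ x ⊓ cap G x + idleNbrs x    ≡⟨ cong (round G σ x ⊓ cap G x +_) (sym (outflow-firing x e)) ⟩
    round G σ x ⊓ cap G x + outflow x     ∎
    where
    open ≤-Reasoning
    e : fire x ≡ true
    e = rich-fires x rich
    0<2deg : 0 < 2 * deg G x
    0<2deg = ≤-trans busy (≤-trans (subst (idleNbrs x ≤_) (sym (deg-split x)) (m≤n+m _ _)) (m≤m+n _ _))
    cap<σ : cap G x < round G σ x + idleNbrs x
    cap<σ = subst (cap G x <_) (sym (round-firing x e)) (<-≤-trans (pred-< 0<2deg) rich)

  potential-mono : potential G σ ≤ potential G (round G σ)
  potential-mono = sumFin-balance n local-balance flow-balance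

  rich-keeps : ∀ x → 2 * deg G x ≤ σ x → potential G (round G σ) ≤ potential G σ → round G σ x ≡ σ x
  rich-keeps x rich stuck with idleNbrs x in eq
  ... | zero  = trans (sym (+-identityʳ _)) (subst (λ k → round G σ x + k ≡ σ x) eq (round-firing x (rich-fires x rich)))
  ... | suc _ = ⊥-elim (<⇒≱ (sumFin-balance-< n local-balance x
                               (local-balance-strict x rich (subst (0 <_) (sym eq) z<s)) flow-balance) stuck)

AllFire : ∀ {n} → Graph n → Config n → Set
AllFire {n} G τ = ∀ v → fires G τ v ≡ true

module _ {n : ℕ} (G : Graph n) where

  -- Every vertex sends and receives exactly deg v candies.
  all-fire-fixed : ∀ {τ} → AllFire G τ → ∀ v → round G τ v ≡ τ v
  all-fire-fixed {τ} af v =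
    trans (sym (+-identityʳ _)) (subst (λ k → round G τ v + k ≡ τ v) no-idle (round-firing v (af v)))
    where
    open OneRound G τ
    no-idle : idleNbrs v ≡ 0
    no-idle = trans (sumFin-cong n (λ u → cong (λ b → ind (adj G v u ∧ not b)) (af u))) (count-false n (adj G v))

  all-fire-forever : ∀ {τ} → AllFire G τ → ∀ ℓ → AllFire G (play G τ ℓ)
  all-fire-forever af zero    = af
  all-fire-forever af (suc ℓ) v =
    trans (cong (λ s → ⌊ deg G v ≤? s ⌋) (all-fire-fixed (all-fire-forever af ℓ) v)) (all-fire-forever af ℓ v)

  frozen : ∀ {τ} → AllFire G τ → ∀ ℓ v → play G τ ℓ v ≡ τ v
  frozen af zero    v = refl
  frozen af (suc ℓ) v = trans (all-fire-fixed (all-fire-forever af ℓ) v) (frozen af ℓ v)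

  play-shift : ∀ τ ℓ → play G (round G τ) ℓ ≡ play G τ (suc ℓ)
  play-shift τ zero    = refl
  play-shift τ (suc ℓ) = cong (round G) (play-shift τ ℓ)

  play-+ : ∀ τ ℓ t → play G τ (ℓ + t) ≡ play G (play G τ t) ℓ
  play-+ τ zero    t = refl
  play-+ τ (suc ℓ) t = cong (round G) (play-+ τ ℓ t)

  play-conservation : ∀ τ ℓ → total (play G τ ℓ) ≡ total τ
  play-conservation τ zero    = refl
  play-conservation τ (suc ℓ) = trans (OneRound.conservation G (play G τ ℓ)) (play-conservation τ ℓ)

  play-potential-mono : ∀ τ ℓ → potential G τ ≤ potential G (play G τ ℓ)
  play-potential-mono τ zero    = ≤-refl
  play-potential-mono τ (suc ℓ) = ≤-trans (play-potential-mono τ ℓ) (OneRound.potential-mono G (play G τ ℓ))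

  -- With at least 4|E| − |V| candies some vertex is rich or every vertex fires:
  -- otherwise every vertex is within its capacity and an idle one strictly so.
  rich-or-all-fire : ∀ τ → 4 * edgeCount G ∸ n ≤ total τ → (∃ λ x → 2 * deg G x ≤ τ x) ⊎ AllFire G τ
  rich-or-all-fire τ enough with any? (λ x → 2 * deg G x ≤? τ x)
  ... | yes rich = inj₁ rich
  ... | no none  = inj₂ fires-at
    where
    open OneRound G τ
    poor : ∀ u → τ u < 2 * deg G u
    poor u = ≰⇒> (λ r → none (u , r))
    nonisolated : ∀ u → 0 < deg G u
    nonisolated u = positive-of-double (deg G u) (≤-<-trans z≤n (poor u))
    fires-at : AllFire G τ
    fires-at v with firing-view v
    ... | inj₁ (e , _)   = e
    ... | inj₂ (_ , τ<d) = ⊥-elim (<⇒≱ (subst (total τ <_) (cap-sum G nonisolated) below) enough)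
      where
      d<2d : deg G v < 2 * deg G v
      d<2d = subst (deg G v <_) (double (deg G v)) (m<m+n (deg G v) (nonisolated v))
      below : total τ < sumFin n (cap G)
      below = sumFin-mono-< n (λ u → <⇒≤pred (poor u)) v (<-≤-trans τ<d (<⇒≤pred d<2d))

module Stabilization {n : ℕ} (G : Graph n) (conn : Connected G) (c : ℕ)
                     (enough : 4 * edgeCount G ∸ n ≤ c) where

  idleTime : Fin n → Config n → ℕ → ℕ
  idleTime v τ zero    = 0
  idleTime v τ (suc ℓ) = OneRound.idle G τ v + idleTime v (round G τ) ℓ

  idle-time-transfer : ∀ ℓ τ w v → adj G w v ≡ true →
    idleTime v τ ℓ + play G τ ℓ w ≤ τ w + deg G w * idleTime w τ ℓ
  idle-time-transfer zero    τ w v a = m≤m+n _ _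
  idle-time-transfer (suc ℓ) τ w v a =
    budget-chain (OneRound.idle G τ v) (idleTime v (round G τ) ℓ) (play G τ (suc ℓ) w)
                 (τ w) (round G τ w) (deg G w) (OneRound.idle G τ w) (idleTime w (round G τ) ℓ)
      (OneRound.idle-transfer G τ w v a)
      (subst (λ τ′ → idleTime v (round G τ) ℓ + τ′ w ≤ round G τ w + deg G w * idleTime w (round G τ) ℓ)
             (play-shift G τ ℓ) (idle-time-transfer ℓ (round G τ) w v a))

  -- Bound on idle rounds propagated backwards along a walk to a never-idle vertex.
  walkWeight : ∀ {v x} → Walk G v x → ℕ
  walkWeight here       = 0
  walkWeight (step _ p) = c + n * walkWeight p

  idle-time-along-walk : ∀ ℓ τ → total τ ≡ c → ∀ x → idleTime x τ ℓ ≡ 0 →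
    ∀ v (p : Walk G v x) → idleTime v τ ℓ ≤ walkWeight p
  idle-time-along-walk ℓ τ tot x never v here = ≤-reflexive never
  idle-time-along-walk ℓ τ tot x never v (step {w = w} a p) = begin
    idleTime v τ ℓ                            ≤⟨ m≤m+n _ _ ⟩
    idleTime v τ ℓ + play G τ ℓ w             ≤⟨ idle-time-transfer ℓ τ w v (trans (Graph.sym G w v) a) ⟩
    τ w + deg G w * idleTime w τ ℓ            ≤⟨ +-mono-≤ (subst (τ w ≤_) tot (term≤sumFin n τ w))
                                                   (*-mono-≤ (count≤n n (adj G w)) (idle-time-along-walk ℓ τ tot x never w p)) ⟩
    c + n * walkWeight p                      ∎
    where open ≤-Reasoning

  -- A vertex that is rich at the start of a window on which the potential does
  -- not grow stays rich, hence never idles.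
  rich-never-idle : ∀ ℓ τ x → 2 * deg G x ≤ τ x → potential G (play G τ ℓ) ≤ potential G τ → idleTime x τ ℓ ≡ 0
  rich-never-idle zero    τ x rich stuck = refl
  rich-never-idle (suc ℓ) τ x rich stuck =
    cong₂ _+_ (cong (ind ∘ not) (OneRound.rich-fires G τ x rich))
              (rich-never-idle ℓ (round G τ) x (subst (2 * deg G x ≤_) (sym keeps) rich) stuck′)
    where
    stuck-at-end : potential G (play G (round G τ) ℓ) ≤ potential G τ
    stuck-at-end = subst (λ τ′ → potential G τ′ ≤ potential G τ) (sym (play-shift G τ ℓ)) stuck
    keeps : round G τ x ≡ τ x
    keeps = OneRound.rich-keeps G τ x rich (≤-trans (play-potential-mono G (round G τ) ℓ) stuck-at-end)
    stuck′ : potential G (play G (round G τ) ℓ) ≤ potential G (round G τ)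
    stuck′ = ≤-trans stuck-at-end (OneRound.potential-mono G τ)

  idle-or-all-fire : ∀ ℓ τ → (∃ λ t → AllFire G (play G τ t)) ⊎ ℓ ≤ sumFin n (λ v → idleTime v τ ℓ)
  idle-or-all-fire zero    τ = inj₂ z≤n
  idle-or-all-fire (suc ℓ) τ with any? (λ v → fires G τ v ≟ᵇ false)
  ... | no none = inj₁ (0 , λ v → ¬-not (λ e → none (v , e)))
  ... | yes (v , e) with idle-or-all-fire ℓ (round G τ)
  ...   | inj₁ (t , af) = inj₁ (suc t , subst (AllFire G) (play-shift G τ t) af)
  ...   | inj₂ later    = inj₂ (subst (suc ℓ ≤_) (sym (sumFin-+ n _ _)) (+-mono-≤ now later))
    where
    now : 1 ≤ sumFin n (OneRound.idle G τ)
    now = ≤-trans (≤-reflexive (cong (ind ∘ not) (sym e))) (term≤sumFin n (OneRound.idle G τ) v)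

  -- Window length: one more than any possible total idle time.
  H : ℕ
  H = sumFin n (λ v → sumFin n (λ u → walkWeight (conn v u)))

  L : ℕ
  L = suc H

  window : ∀ τ → total τ ≡ c → (∃ λ t → AllFire G (play G τ t)) ⊎ potential G τ < potential G (play G τ L)
  window τ tot with potential G (play G τ L) ≤? potential G τ
  ... | no grows = inj₂ (≰⇒> grows)
  ... | yes stuck with rich-or-all-fire G τ (subst (_ ≤_) (sym tot) enough)
  ...   | inj₂ af = inj₁ (0 , af)
  ...   | inj₁ (x , rich) with idle-or-all-fire L τ
  ...     | inj₁ done = inj₁ done
  ...     | inj₂ many = ⊥-elim (<⇒≱ (n<1+n H) (≤-trans many total-idle≤H))
    where
    total-idle≤H : sumFin n (λ v → idleTime v τ L) ≤ H
    total-idle≤H = ≤-trans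
      (sumFin-mono n (λ v → idle-time-along-walk L τ tot x (rich-never-idle L τ x rich stuck) v (conn v x)))
      (sumFin-mono n (λ v → term≤sumFin n (λ u → walkWeight (conn v u)) x))

  -- The potential is bounded by the total capacity, so it can grow in at most that many windows.
  all-fire-within : ∀ k τ → total τ ≡ c → sumFin n (cap G) ≤ potential G τ + k → ∃ λ t → AllFire G (play G τ t)
  all-fire-within k τ tot room with window τ tot
  ... | inj₁ done = done
  ... | inj₂ grows with k
  ...   | zero   = ⊥-elim (<⇒≱ grows (≤-trans (potential≤cap-sum G _) (subst (_ ≤_) (+-identityʳ _) room)))
  ...   | suc k′ with all-fire-within k′ (play G τ L) (trans (play-conservation G τ L) tot)
                        (≤-trans room (subst (_≤ potential G (play G τ L) + k′) (sym (+-suc _ k′)) (+-monoˡ-≤ k′ grows)))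
  ...     | t , af = t + L , subst (AllFire G) (sym (play-+ G τ t L)) af

  eventually-all-fire : ∀ τ → total τ ≡ c → ∃ λ t → AllFire G (play G τ t)
  eventually-all-fire τ tot = all-fire-within (sumFin n (cap G)) τ tot (m≤n+m _ _)

-- The theorem: from the first time all vertices fire, the configuration is frozen.

theorem1 : ∀ {n : ℕ} (G : Graph n) → Connected G →
    (σ : Config n) → 0 < total σ → 4 * edgeCount G ∸ n ≤ total σ →
    ∃ λ T → ∀ (v : Fin n) (t : ℕ) → T ≤ t → play G σ t v ≡ play G σ T v
theorem1 G conn σ _ enough with Stabilization.eventually-all-fire G conn (total σ) enough σ refl
... | T , af = T , stable
  where
  open ≡-Reasoning
  stable : ∀ v t → T ≤ t → play G σ t v ≡ play G σ T v
  stable v t T≤t = begin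
    play G σ t v                  ≡⟨ cong (λ s → play G σ s v) (sym (m∸n+n≡m T≤t)) ⟩
    play G σ (t ∸ T + T) v        ≡⟨ cong (λ τ → τ v) (play-+ G σ (t ∸ T) T) ⟩
    play G (play G σ T) (t ∸ T) v ≡⟨ frozen G af (t ∸ T) v ⟩
    play G σ T v                  ∎
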